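{- Let $M\in\mathbb{Z}^{\ell\times m}$ have full column rank and $F\in\mathbb{Z}^{n\times m}$. Let $T$ be the Hermite basis of $\mathcal{L}(M) + \mathcal{L}(F)$. Then the matrix $\begin{bmatrix} T & 0& I_m \\ F & I_n & 0 \\ M &0 &0 \end{bmatrix}$ has Hermite basis of the shape $\begin{bmatrix} T &0 & \ast \\ 0 & I_n & C\\ 0 &0 & K \end{bmatrix}$ for some integer matrices $C\in\mathbb{Z}^{n\times m}$, $K\in\mathbb{Z}^{m\times m}$, and $\mathcal{R}(M,F)=\mathcal{R}(K,C)$, where $K$ and $C$ are coprime.
   Context: $\mathcal{L}(X)$ is the lattice of $\mathbb{Z}$-linear combinations of the rows of $X$. The Hermite basis of a full column rank integer matrix $X$ is the unique square nonsingular matrix in (row) Hermite form (upper triangular, positive diagonal, entries above each diagonal entry $h_j$ in column $j$ lying in $[0,h_j)$) with the same row lattice as $X$. For $M$ of full column rank and $F$ with the same number of columns, $\mathcal{R}(M,F)=\{p\in\mathbb{Z}^{1\times n} : pF=qM \text{ for some integer row vector } q\}$. Two integer matrices $K$ and $C$ with the same number of columns, with $\begin{bmatrix}K\\C\end{bmatrix}$ of full column rank, are coprime if the Hermite basis of $\begin{bmatrix}K\\C\end{bmatrix}$ is the identity. -}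

module Defs where

open import Data.Nat using (ℕ; zero; suc) renaming (_+_ to _+ℕ_)
open import Data.Integer using (ℤ; 0ℤ; 1ℤ; _+_; _*_; _<_; _≤_)
open import Data.Fin using (Fin; zero; suc; splitAt; toℕ)
import Data.Fin as F
open import Data.Sum using ([_,_]′)
open import Data.Product using (Σ; ∃; _×_; _,_)
open import Relation.Binary.PropositionalEquality using (_≡_)
open import Relation.Nullary.Decidable using (⌊_⌋)

Mat : ℕ → ℕ → Set
Mat r c = Fin r → Fin c → ℤ

RowVec : ℕ → Set
RowVec c = Fin c → ℤ

sumF : ∀ {n} → (Fin n → ℤ) → ℤ
sumF {zero}  f = 0ℤ
sumF {suc n} f = f zero + sumF (λ i → f (suc i))

_·_ : ∀ {r c} → RowVec r → Mat r c → RowVec c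
(q · X) j = sumF (λ i → q i * X i j)

zeroMat : ∀ {r c} → Mat r c
zeroMat _ _ = 0ℤ

identity : ∀ {n} → Mat n n
identity i j = if ⌊ i F.≟ j ⌋ then 1ℤ else 0ℤ
  where open import Data.Bool using (if_then_else_)

infixl 5 _⊤⊥_
infixl 6 _∥_
_⊤⊥_ : ∀ {r s c} → Mat r c → Mat s c → Mat (r +ℕ s) c
_⊤⊥_ {r} X Y i j = [ (λ i′ → X i′ j) , (λ i′ → Y i′ j) ]′ (splitAt r i)

_∥_ : ∀ {r c d} → Mat r c → Mat r d → Mat r (c +ℕ d)
_∥_ {c = c} X Y i j = [ (λ j′ → X i j′) , (λ j′ → Y i j′) ]′ (splitAt c j)

_≋_ : ∀ {r c} → Mat r c → Mat r c → Set
X ≋ Y = ∀ i j → X i j ≡ Y i j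

_∈L_ : ∀ {r c} → RowVec c → Mat r c → Set
v ∈L X = ∃ λ q → ∀ j → (q · X) j ≡ v j

FullColRank : ∀ {r c} → Mat r c → Set
FullColRank {c = c} X =
  (v : Fin c → ℤ) → (∀ i → sumF (λ j → X i j * v j) ≡ 0ℤ) → ∀ j → v j ≡ 0ℤ

-- Row Hermite form of a square matrix: upper triangular, positive diagonal,
-- entries above the diagonal entry h_j in column j lying in [0, h_j).
-- (Such a matrix is automatically nonsingular.)
IsHermiteForm : ∀ {k} → Mat k k → Set
IsHermiteForm H =
  (∀ i j → toℕ j Data.Nat.< toℕ i → H i j ≡ 0ℤ) ×
  (∀ i → 0ℤ < H i i) ×
  (∀ i j → toℕ i Data.Nat.< toℕ j → (0ℤ ≤ H i j) × (H i j < H j j))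
  where import Data.Nat

IsHermiteBasisOfLattice : ∀ {k} → Mat k k → (RowVec k → Set) → Set
IsHermiteBasisOfLattice H P =
  IsHermiteForm H × (∀ v → (v ∈L H → P v) × (P v → v ∈L H))

IsHermiteBasis : ∀ {r k} → Mat k k → Mat r k → Set
IsHermiteBasis H X = IsHermiteBasisOfLattice H (λ v → v ∈L X)

LatSum : ∀ {l n m} → Mat l m → Mat n m → RowVec m → Set
LatSum M F v = ∃ λ a → ∃ λ b → a ∈L M × b ∈L F × (∀ j → v j ≡ a j + b j)

_∈R[_,_] : ∀ {l n m} → RowVec n → Mat l m → Mat n m → Set
p ∈R[ M , F ] = ∃ λ q → ∀ j → (p · F) j ≡ (q · M) j

-- K and C coprime: [K ; C] has full column rank and Hermite basis the identity
Coprime : ∀ {a b m} → Mat a m → Mat b m → Set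
Coprime K C = FullColRank (K ⊤⊥ C) × IsHermiteBasis identity (K ⊤⊥ C)

{-# OPTIONS --safe #-}
module Submission where

-- Since L(T) = L(M) + L(F), write M = G T and F = U T. As T is triangular with nonzero
-- diagonal it cancels on the right, so G inherits full column rank from M. Let K be the
-- Hermite basis of G (built column by column from Bézout's identity) and X, C the
-- reductions of I and -U modulo L(K). Integer row operations carry
-- [T 0 I; F I 0; M 0 0] to [T 0 X; 0 I C; 0 0 K], using that [0 0 w] lies in both row
-- lattices whenever w ∈ L(G) = L(K); the latter matrix is in Hermite form blockwise.
-- Cancelling T, pF = qM iff pU = qG, i.e. pU ∈ L(K), and as the rows of U + C lie in
-- L(K) this says pC ∈ L(K). Finally each row of T is αM + βF = (αG + βU)T, so
-- eⱼ = αG + βU lies in L([K; C]), which is therefore all of ℤᵐ.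

open import Defs
open import Data.Nat using (ℕ; zero; suc; z≤n; s≤s)
import Data.Nat as ℕ
import Data.Nat.Properties as ℕₚ
import Data.Nat.GCD as ℕGCD
open import Data.Integer as ℤ
  using (ℤ; 0ℤ; 1ℤ; -1ℤ; _+_; _*_; -_; _-_; _<_; _≤_; +<+; +≤+; ∣_∣)
import Data.Integer.Properties as ℤₚ
open import Data.Integer.DivMod using (_/_; _%_; a≡a%n+[a/n]*n; n%d<d)
open import Data.Integer.GCD using (gcd; gcd[i,j]∣i; gcd[i,j]∣j)
open import Data.Integer.Divisibility.Signed using (_∣_; divides; quotient; ∣ᵤ⇒∣; ∣-trans)
open import Data.Integer.Tactic.RingSolver using (solve-∀)
open import Algebra.Properties.Semiring.Sum ℤₚ.+-*-semiring
  using (sum; ∑-distrib-+; ∑-comm; *-distribˡ-sum)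
open import Data.Fin as Fin using (Fin; zero; suc; splitAt; toℕ; _↑ˡ_; _↑ʳ_)
open import Data.Fin.Properties
  using (splitAt-↑ˡ; splitAt-↑ʳ; splitAt⁻¹-↑ˡ; splitAt⁻¹-↑ʳ; toℕ-↑ˡ; toℕ-↑ʳ; toℕ<n)
open import Data.Vec.Functional using (_∷_; tail; _++_; zipWith; map; foldr)
open import Data.Sum using (inj₁; inj₂)
open import Data.Product using (∃; ∃₂; _×_; _,_; proj₁; proj₂)
open import Data.Empty using (⊥-elim)
open import Function using (_∘_)
open import Relation.Binary.PropositionalEquality
open import Relation.Nullary using (¬_; yes; no)

infixl 6 _+ᵥ_ _-ᵥ_
infixl 7 _*ᵥ_
infix 7 _⊙_

0ᵥ : ∀ {c} → RowVec c
0ᵥ _ = 0ℤ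

_+ᵥ_ _-ᵥ_ : ∀ {c} → RowVec c → RowVec c → RowVec c
_+ᵥ_ = zipWith _+_
_-ᵥ_ = zipWith _-_

_*ᵥ_ : ∀ {c} → ℤ → RowVec c → RowVec c
a *ᵥ u = map (a *_) u

_⊙_ : ∀ {c} → RowVec c → RowVec c → ℤ
u ⊙ v = sumF (λ j → u j * v j)

x+[y-x]≡y : ∀ x y → x + (y - x) ≡ y
x+[y-x]≡y = solve-∀

x-[x-y]≡y : ∀ x y → x - (x - y) ≡ y
x-[x-y]≡y = solve-∀

x+y-x≡y : ∀ x y → x + y - x ≡ y
x+y-x≡y = solve-∀

x+y-y≡x : ∀ x y → x + y - y ≡ x
x+y-y≡x = solve-∀

sumF≡sum : ∀ {n} (f : Fin n → ℤ) → sumF f ≡ sum f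
sumF≡sum {zero}  f = refl
sumF≡sum {suc n} f = cong (f zero +_) (sumF≡sum (f ∘ suc))

sumF-cong : ∀ {n} {f g : Fin n → ℤ} → f ≗ g → sumF f ≡ sumF g
sumF-cong {zero}  f≗g = refl
sumF-cong {suc n} f≗g = cong₂ _+_ (f≗g zero) (sumF-cong (f≗g ∘ suc))

sumF-zero : ∀ {n} {f : Fin n → ℤ} → (∀ i → f i ≡ 0ℤ) → sumF f ≡ 0ℤ
sumF-zero {zero}  f≡0 = refl
sumF-zero {suc n} f≡0 = cong₂ _+_ (f≡0 zero) (sumF-zero (f≡0 ∘ suc))

sumF-+ : ∀ {n} (f g : Fin n → ℤ) → sumF (λ i → f i + g i) ≡ sumF f + sumF g
sumF-+ f g rewrite sumF≡sum f | sumF≡sum g | sumF≡sum (λ i → f i + g i) = ∑-distrib-+ f g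

sumF-*ˡ : ∀ {n} a (f : Fin n → ℤ) → sumF (λ i → a * f i) ≡ a * sumF f
sumF-*ˡ a f rewrite sumF≡sum f | sumF≡sum (λ i → a * f i) = sym (*-distribˡ-sum a f)

sumF-*ʳ : ∀ {n} a (f : Fin n → ℤ) → sumF (λ i → f i * a) ≡ sumF f * a
sumF-*ʳ a f = trans (sumF-cong (λ i → ℤₚ.*-comm (f i) a)) (trans (sumF-*ˡ a f) (ℤₚ.*-comm a _))

sumF-swap : ∀ {m n} (f : Fin m → Fin n → ℤ) →
            sumF (λ i → sumF (f i)) ≡ sumF (λ j → sumF (λ i → f i j))
sumF-swap f = begin
  sumF (λ i → sumF (f i))          ≡⟨ sumF-cong (λ i → sumF≡sum (f i)) ⟩
  sumF (λ i → sum (f i))           ≡⟨ sumF≡sum (λ i → sum (f i)) ⟩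
  sum (λ i → sum (f i))            ≡⟨ ∑-comm f ⟩
  sum (λ j → sum (λ i → f i j))    ≡⟨ sumF≡sum (λ j → sum (λ i → f i j)) ⟨
  sumF (λ j → sum (λ i → f i j))   ≡⟨ sumF-cong (λ j → sumF≡sum (λ i → f i j)) ⟨
  sumF (λ j → sumF (λ i → f i j))  ∎
  where open ≡-Reasoning

identity-diag : ∀ {n} (i : Fin n) → identity i i ≡ 1ℤ
identity-diag i with i Fin.≟ i
... | yes _  = refl
... | no i≢i = ⊥-elim (i≢i refl)

identity-offDiag : ∀ {n} {i j : Fin n} → i ≢ j → identity i j ≡ 0ℤ
identity-offDiag {i = i} {j} i≢j with i Fin.≟ j
... | yes i≡j = ⊥-elim (i≢j i≡j)
... | no _    = refl

identity-suc : ∀ {n} (i j : Fin n) → identity (suc i) (suc j) ≡ identity i j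
identity-suc i j with i Fin.≟ j
... | yes refl = refl
... | no _     = refl

identity-sym : ∀ {n} (i j : Fin n) → identity i j ≡ identity j i
identity-sym i j with i Fin.≟ j | j Fin.≟ i
... | yes _   | yes _   = refl
... | no _    | no _    = refl
... | yes i≡j | no j≢i  = ⊥-elim (j≢i (sym i≡j))
... | no i≢j  | yes j≡i = ⊥-elim (i≢j (sym j≡i))

sumF-select : ∀ {n} (f : Fin n → ℤ) k → sumF (λ i → f i * identity i k) ≡ f k
sumF-select f zero = begin
  f zero * 1ℤ + sumF (λ i → f (suc i) * identity (suc i) zero)
    ≡⟨ cong₂ _+_ (ℤₚ.*-identityʳ (f zero)) (sumF-zero (λ i → ℤₚ.*-zeroʳ (f (suc i)))) ⟩
  f zero + 0ℤ
    ≡⟨ ℤₚ.+-identityʳ (f zero) ⟩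
  f zero ∎
  where open ≡-Reasoning
sumF-select f (suc k) = begin
  f zero * 0ℤ + sumF (λ i → f (suc i) * identity (suc i) (suc k))
    ≡⟨ cong₂ _+_ (ℤₚ.*-zeroʳ (f zero)) (sumF-cong (λ i → cong (f (suc i) *_) (identity-suc i k))) ⟩
  0ℤ + sumF (λ i → f (suc i) * identity i k)
    ≡⟨ ℤₚ.+-identityˡ _ ⟩
  sumF (λ i → f (suc i) * identity i k)
    ≡⟨ sumF-select (f ∘ suc) k ⟩
  f (suc k) ∎
  where open ≡-Reasoning

⊙-congˡ : ∀ {c} {u u′ : RowVec c} v → u ≗ u′ → u ⊙ v ≡ u′ ⊙ v
⊙-congˡ v u≗u′ = sumF-cong (λ j → cong (_* v j) (u≗u′ j))

⊙-congʳ : ∀ {c} u {v v′ : RowVec c} → v ≗ v′ → u ⊙ v ≡ u ⊙ v′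
⊙-congʳ u v≗v′ = sumF-cong (λ j → cong (u j *_) (v≗v′ j))

⊙-zeroʳ : ∀ {c} (u : RowVec c) {v} → (∀ j → v j ≡ 0ℤ) → u ⊙ v ≡ 0ℤ
⊙-zeroʳ u v≡0 = sumF-zero (λ j → trans (cong (u j *_) (v≡0 j)) (ℤₚ.*-zeroʳ (u j)))

⊙-*ʳ : ∀ {c} (u : RowVec c) a v → u ⊙ (a *ᵥ v) ≡ a * (u ⊙ v)
⊙-*ʳ u a v = trans (sumF-cong (λ j → swap-factor (u j) a (v j))) (sumF-*ˡ a (λ j → u j * v j))
  where
  swap-factor : ∀ x a y → x * (a * y) ≡ a * (x * y)
  swap-factor = solve-∀

⊙-*ˡ : ∀ {c} a (u : RowVec c) v → (a *ᵥ u) ⊙ v ≡ a * (u ⊙ v)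
⊙-*ˡ a u v = trans (sumF-cong (λ j → ℤₚ.*-assoc a (u j) (v j))) (sumF-*ˡ a (λ j → u j * v j))

·-⊙-assoc : ∀ {r c} (q : RowVec r) (X : Mat r c) v → (q · X) ⊙ v ≡ q ⊙ (λ i → X i ⊙ v)
·-⊙-assoc q X v = begin
  sumF (λ j → sumF (λ i → q i * X i j) * v j)
    ≡⟨ sumF-cong (λ j → sumF-*ʳ (v j) (λ i → q i * X i j)) ⟨
  sumF (λ j → sumF (λ i → q i * X i j * v j))
    ≡⟨ sumF-swap (λ j i → q i * X i j * v j) ⟩
  sumF (λ i → sumF (λ j → q i * X i j * v j))
    ≡⟨ sumF-cong (λ i → sumF-cong (λ j → ℤₚ.*-assoc (q i) (X i j) (v j))) ⟩
  sumF (λ i → sumF (λ j → q i * (X i j * v j)))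
    ≡⟨ sumF-cong (λ i → sumF-*ˡ (q i) (λ j → X i j * v j)) ⟩
  sumF (λ i → q i * sumF (λ j → X i j * v j))
    ∎
  where open ≡-Reasoning

·-assoc : ∀ {r k c} (q : RowVec r) (A : Mat r k) (B : Mat k c) →
          q · (λ i → A i · B) ≗ (q · A) · B
·-assoc q A B j = sym (·-⊙-assoc q A (λ k → B k j))

·-factor : ∀ {r k c} {X : Mat r c} {Y : Mat r k} {T : Mat k c} → (∀ i → Y i · T ≗ X i) →
           ∀ p → p · X ≗ (p · Y) · T
·-factor {Y = Y} {T} Y·T≗X p j =
  trans (sumF-cong (λ i → cong (p i *_) (sym (Y·T≗X i j)))) (·-assoc p Y T j)

·-cong : ∀ {r c} {q q′ : RowVec r} {X Y : Mat r c} →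
         q ≗ q′ → (∀ i → X i ≗ Y i) → q · X ≗ q′ · Y
·-cong q≗q′ X≗Y j = sumF-cong (λ i → cong₂ _*_ (q≗q′ i) (X≗Y i j))

·-+ᵥ : ∀ {r c} (q q′ : RowVec r) (X : Mat r c) → (q +ᵥ q′) · X ≗ q · X +ᵥ q′ · X
·-+ᵥ q q′ X j = trans (sumF-cong (λ i → ℤₚ.*-distribʳ-+ (X i j) (q i) (q′ i)))
                      (sumF-+ (λ i → q i * X i j) (λ i → q′ i * X i j))

·-*ᵥ : ∀ {r c} a (q : RowVec r) (X : Mat r c) → (a *ᵥ q) · X ≗ a *ᵥ (q · X)
·-*ᵥ a q X j = trans (sumF-cong (λ i → ℤₚ.*-assoc a (q i) (X i j)))
                     (sumF-*ˡ a (λ i → q i * X i j))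

·-rows-+ᵥ : ∀ {r c} (q : RowVec r) (A B : Mat r c) →
            q · (λ i → A i +ᵥ B i) ≗ q · A +ᵥ q · B
·-rows-+ᵥ q A B j = trans (sumF-cong (λ i → ℤₚ.*-distribˡ-+ (q i) (A i j) (B i j)))
                          (sumF-+ (λ i → q i * A i j) (λ i → q i * B i j))

·-rows--ᵥ : ∀ {r c} (q : RowVec r) (A B : Mat r c) →
            q · (λ i → A i -ᵥ B i) ≗ q · A -ᵥ q · B
·-rows--ᵥ q A B j = begin
  sumF (λ i → q i * (A i j - B i j))
    ≡⟨ sumF-cong (λ i → distrib (q i) (A i j) (B i j)) ⟩
  sumF (λ i → q i * A i j + -1ℤ * (q i * B i j))
    ≡⟨ sumF-+ (λ i → q i * A i j) _ ⟩
  (q · A) j + sumF (λ i → -1ℤ * (q i * B i j))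
    ≡⟨ cong ((q · A) j +_) (sumF-*ˡ -1ℤ (λ i → q i * B i j)) ⟩
  (q · A) j + -1ℤ * (q · B) j
    ≡⟨ cong ((q · A) j +_) (ℤₚ.-1*i≡-i ((q · B) j)) ⟩
  (q · A) j - (q · B) j
    ∎
  where
  open ≡-Reasoning
  distrib : ∀ q a b → q * (a - b) ≡ q * a + -1ℤ * (q * b)
  distrib = solve-∀

·-identity : ∀ {n} (q : RowVec n) → q · identity ≗ q
·-identity = sumF-select

identity-· : ∀ {r c} k (X : Mat r c) → identity k · X ≗ X k
identity-· k X j = trans (sumF-cong (λ i → trans (ℤₚ.*-comm (identity k i) (X i j))
                                                 (cong (X i j *_) (identity-sym k i))))
                         (sumF-select (λ i → X i j) k)

·-zeroMat : ∀ {r c} (q : RowVec r) → q · zeroMat {r} {c} ≗ 0ᵥ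
·-zeroMat q j = sumF-zero (λ i → ℤₚ.*-zeroʳ (q i))

-- A record copy of _∈L_: unlike the Σ-type it unfolds to, the record type
-- former is injective, so Agda can infer the matrix from a membership proof.
record _∈ᴸ_ {r c} (v : RowVec c) (X : Mat r c) : Set where
  constructor ⟨_,_⟩
  field
    coefficients : RowVec r
    combination  : coefficients · X ≗ v

infix 4 _∈ᴸ_ _⊆ᴸ_ _≈ᴸ_

∈L⇒∈ᴸ : ∀ {r c} {v} {X : Mat r c} → v ∈L X → v ∈ᴸ X
∈L⇒∈ᴸ (q , q·X≗v) = ⟨ q , q·X≗v ⟩

∈ᴸ⇒∈L : ∀ {r c} {v} {X : Mat r c} → v ∈ᴸ X → v ∈L X
∈ᴸ⇒∈L ⟨ q , q·X≗v ⟩ = q , q·X≗v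

_⊆ᴸ_ : ∀ {r s c} → Mat r c → Mat s c → Set
X ⊆ᴸ Y = ∀ {v} → v ∈ᴸ X → v ∈ᴸ Y

_≈ᴸ_ : ∀ {r s c} → Mat r c → Mat s c → Set
X ≈ᴸ Y = X ⊆ᴸ Y × Y ⊆ᴸ X

∈ᴸ-resp-≗ : ∀ {r c} {X : Mat r c} {v w} → v ∈ᴸ X → v ≗ w → w ∈ᴸ X
∈ᴸ-resp-≗ ⟨ q , q·X≗v ⟩ v≗w = ⟨ q , (λ j → trans (q·X≗v j) (v≗w j)) ⟩

·-∈ᴸ : ∀ {r c} (q : RowVec r) (X : Mat r c) → q · X ∈ᴸ X
·-∈ᴸ q X = ⟨ q , (λ _ → refl) ⟩

0ᵥ-∈ᴸ : ∀ {r c} (X : Mat r c) → 0ᵥ ∈ᴸ X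
0ᵥ-∈ᴸ X = ⟨ 0ᵥ , (λ j → sumF-zero (λ i → ℤₚ.*-zeroˡ (X i j))) ⟩

row-∈ᴸ : ∀ {r c} (X : Mat r c) i → X i ∈ᴸ X
row-∈ᴸ X i = ⟨ identity i , identity-· i X ⟩

+ᵥ-∈ᴸ : ∀ {r c} {X : Mat r c} {v w} → v ∈ᴸ X → w ∈ᴸ X → v +ᵥ w ∈ᴸ X
+ᵥ-∈ᴸ {X = X} ⟨ p , p·X≗v ⟩ ⟨ q , q·X≗w ⟩ =
  ⟨ p +ᵥ q , (λ j → trans (·-+ᵥ p q X j) (cong₂ _+_ (p·X≗v j) (q·X≗w j))) ⟩

*ᵥ-∈ᴸ : ∀ {r c} {X : Mat r c} a {v} → v ∈ᴸ X → a *ᵥ v ∈ᴸ X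
*ᵥ-∈ᴸ {X = X} a ⟨ q , q·X≗v ⟩ =
  ⟨ a *ᵥ q , (λ j → trans (·-*ᵥ a q X j) (cong (a *_) (q·X≗v j))) ⟩

-ᵥ-∈ᴸ : ∀ {r c} {X : Mat r c} {v w} → v ∈ᴸ X → w ∈ᴸ X → v -ᵥ w ∈ᴸ X
-ᵥ-∈ᴸ {v = v} {w} v∈ w∈ =
  ∈ᴸ-resp-≗ (+ᵥ-∈ᴸ v∈ (*ᵥ-∈ᴸ -1ℤ w∈)) (λ j → cong (v j +_) (ℤₚ.-1*i≡-i (w j)))

rows⇒⊆ᴸ : ∀ {r s c} {X : Mat r c} {Y : Mat s c} → (∀ i → X i ∈ᴸ Y) → X ⊆ᴸ Y
rows⇒⊆ᴸ {r} {s} {X = X} {Y} rows {v} ⟨ q , q·X≗v ⟩ = ⟨ q · P , (λ j → begin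
  ((q · P) · Y) j            ≡⟨ ·-assoc q P Y j ⟨
  (q · (λ i → P i · Y)) j    ≡⟨ ·-cong {q = q} (λ _ → refl) (_∈ᴸ_.combination ∘ rows) j ⟩
  (q · X) j                  ≡⟨ q·X≗v j ⟩
  v j                        ∎) ⟩
  where
  open ≡-Reasoning
  P : Mat r s
  P i = _∈ᴸ_.coefficients (rows i)

≈ᴸ-byRows : ∀ {r s c} {X : Mat r c} {Y : Mat s c} →
            (∀ i → X i ∈ᴸ Y) → (∀ i → Y i ∈ᴸ X) → X ≈ᴸ Y
≈ᴸ-byRows X⊆Y Y⊆X = rows⇒⊆ᴸ X⊆Y , rows⇒⊆ᴸ Y⊆X

≈ᴸ-sym : ∀ {r s c} {X : Mat r c} {Y : Mat s c} → X ≈ᴸ Y → Y ≈ᴸ X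
≈ᴸ-sym (X⊆Y , Y⊆X) = Y⊆X , X⊆Y

≈ᴸ-trans : ∀ {r s t c} {X : Mat r c} {Y : Mat s c} {Z : Mat t c} →
           X ≈ᴸ Y → Y ≈ᴸ Z → X ≈ᴸ Z
≈ᴸ-trans (X⊆Y , Y⊆X) (Y⊆Z , Z⊆Y) = Y⊆Z ∘ X⊆Y , Y⊆X ∘ Z⊆Y

≈ᴸ⇒IsHermiteBasis : ∀ {r k} {H : Mat k k} {G : Mat r k} →
                    IsHermiteForm H → H ≈ᴸ G → IsHermiteBasis H G
≈ᴸ⇒IsHermiteBasis hf (H⊆G , G⊆H) =
  hf , λ v → ∈ᴸ⇒∈L ∘ H⊆G ∘ ∈L⇒∈ᴸ , ∈ᴸ⇒∈L ∘ G⊆H ∘ ∈L⇒∈ᴸ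

⊆ᴸ-⊤⊥ˡ : ∀ {r s c} {X : Mat r c} {Y : Mat s c} → X ⊆ᴸ X ⊤⊥ Y
⊆ᴸ-⊤⊥ˡ {r} {s} {X = X} {Y} = rows⇒⊆ᴸ λ i → ∈ᴸ-resp-≗ (row-∈ᴸ (X ⊤⊥ Y) (i ↑ˡ s)) (lookup i)
  where
  lookup : ∀ i j → (X ⊤⊥ Y) (i ↑ˡ s) j ≡ X i j
  lookup i j rewrite splitAt-↑ˡ r i s = refl

⊆ᴸ-⊤⊥ʳ : ∀ {r s c} {X : Mat r c} {Y : Mat s c} → Y ⊆ᴸ X ⊤⊥ Y
⊆ᴸ-⊤⊥ʳ {r} {s} {X = X} {Y} = rows⇒⊆ᴸ λ i → ∈ᴸ-resp-≗ (row-∈ᴸ (X ⊤⊥ Y) (r ↑ʳ i)) (lookup i)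
  where
  lookup : ∀ i j → (X ⊤⊥ Y) (r ↑ʳ i) j ≡ Y i j
  lookup i j rewrite splitAt-↑ʳ r s i = refl

rows-⊤⊥ : ∀ {r s t c} {X : Mat r c} {Y : Mat s c} {Z : Mat t c} →
          (∀ i → X i ∈ᴸ Z) → (∀ i → Y i ∈ᴸ Z) → ∀ i → (X ⊤⊥ Y) i ∈ᴸ Z
rows-⊤⊥ {r} X⊆Z Y⊆Z i with splitAt r i
... | inj₁ i′ = X⊆Z i′
... | inj₂ i′ = Y⊆Z i′

record IsUpperTriangular {k} (T : Mat k k) : Set where
  field
    below-zero    : ∀ i j → toℕ j ℕ.< toℕ i → T i j ≡ 0ℤ
    diagonal-pos  : ∀ i → 0ℤ < T i i

IsHermiteForm⇒IsUpperTriangular : ∀ {k} {H : Mat k k} → IsHermiteForm H → IsUpperTriangular H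
IsHermiteForm⇒IsUpperTriangular (below , diagonal , _) =
  record { below-zero = below ; diagonal-pos = diagonal }

lowerRight : ∀ {r c} → Mat (suc r) (suc c) → Mat r c
lowerRight X i = tail (X (suc i))

IsUpperTriangular-lowerRight : ∀ {k} {T : Mat (suc k) (suc k)} →
                               IsUpperTriangular T → IsUpperTriangular (lowerRight T)
IsUpperTriangular-lowerRight ut = record
  { below-zero   = λ i j j<i → below-zero (suc i) (suc j) (s≤s j<i)
  ; diagonal-pos = diagonal-pos ∘ suc
  }
  where open IsUpperTriangular ut

-- Back substitution, clearing denominators: d is the product of the diagonal entries.
triangular-solve : ∀ {k} {T : Mat k k} → IsUpperTriangular T → (b : RowVec k) →
                   ∃₂ λ d w → ℤ.NonZero d × ∀ i → T i ⊙ w ≡ d * b i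
triangular-solve {zero} ut b = 1ℤ , (λ ()) , _ , λ ()
triangular-solve {suc k} {T} ut b
  with d′ , w′ , d′≢0 , solves′ ← triangular-solve (IsUpperTriangular-lowerRight ut) (tail b) =
  t * d′ , w , ℤₚ.i*j≢0 t d′ {{ℤ.>-nonZero (diagonal-pos zero)}} {{d′≢0}} , solves
  where
  open IsUpperTriangular ut
  open ≡-Reasoning
  t r : ℤ
  t = T zero zero
  r = tail (T zero) ⊙ w′
  w : RowVec (suc k)
  w = (d′ * b zero - r) ∷ t *ᵥ w′
  cancel : ∀ t d b r → t * (d * b - r) + t * r ≡ t * d * b
  cancel = solve-∀
  solves : ∀ i → T i ⊙ w ≡ t * d′ * b i
  solves zero = begin
    t * (d′ * b zero - r) + tail (T zero) ⊙ (t *ᵥ w′)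
      ≡⟨ cong (t * (d′ * b zero - r) +_) (⊙-*ʳ (tail (T zero)) t w′) ⟩
    t * (d′ * b zero - r) + t * r
      ≡⟨ cancel t d′ (b zero) r ⟩
    t * d′ * b zero
      ∎
  solves (suc i) = begin
    T (suc i) zero * w zero + tail (T (suc i)) ⊙ (t *ᵥ w′)
      ≡⟨ cong₂ _+_ (cong (_* w zero) (below-zero (suc i) zero (s≤s z≤n)))
                   (⊙-*ʳ (tail (T (suc i))) t w′) ⟩
    0ℤ * w zero + t * (lowerRight T i ⊙ w′)
      ≡⟨ cong (0ℤ * w zero +_) (cong (t *_) (solves′ i)) ⟩
    0ℤ * w zero + t * (d′ * b (suc i))
      ≡⟨ ℤₚ.+-identityˡ _ ⟩
    t * (d′ * b (suc i))
      ≡⟨ ℤₚ.*-assoc t d′ (b (suc i)) ⟨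
    t * d′ * b (suc i)
      ∎

-- Pair both sides with a solution of T w = d eₖ.
·-cancelʳ : ∀ {k} {T : Mat k k} → IsUpperTriangular T → ∀ a b → a · T ≗ b · T → a ≗ b
·-cancelʳ {T = T} ut a b a·T≗b·T k
  with d , w , d≢0 , solves ← triangular-solve ut (λ i → identity i k) =
  ℤₚ.*-cancelˡ-≡ d (a k) (b k) {{d≢0}}
    (trans (sym (pairing a)) (trans (⊙-congˡ w a·T≗b·T) (pairing b)))
  where
  open ≡-Reasoning
  pairing : ∀ a → (a · T) ⊙ w ≡ d * a k
  pairing a = begin
    (a · T) ⊙ w                    ≡⟨ ·-⊙-assoc a T w ⟩
    a ⊙ (λ i → T i ⊙ w)            ≡⟨ ⊙-congʳ a solves ⟩
    a ⊙ (d *ᵥ λ i → identity i k)  ≡⟨ ⊙-*ʳ a d (λ i → identity i k) ⟩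
    d * (a ⊙ λ i → identity i k)   ≡⟨ cong (d *_) (sumF-select a k) ⟩
    d * a k                        ∎

∈ᴸ-⊙-zero : ∀ {r c} {Y : Mat r c} {w v} →
            w ∈ᴸ Y → (∀ k → Y k ⊙ v ≡ 0ℤ) → w ⊙ v ≡ 0ℤ
∈ᴸ-⊙-zero {Y = Y} {w} {v} ⟨ q , q·Y≗w ⟩ Yv≡0 = begin
  w ⊙ v                ≡⟨ ⊙-congˡ v (sym ∘ q·Y≗w) ⟩
  (q · Y) ⊙ v          ≡⟨ ·-⊙-assoc q Y v ⟩
  q ⊙ (λ k → Y k ⊙ v)  ≡⟨ ⊙-zeroʳ q Yv≡0 ⟩
  0ℤ                   ∎
  where open ≡-Reasoning

FullColRank-⊆ᴸ : ∀ {r s c} {X : Mat r c} {Y : Mat s c} →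
                 X ⊆ᴸ Y → FullColRank X → FullColRank Y
FullColRank-⊆ᴸ {X = X} X⊆Y fcrX v Yv≡0 =
  fcrX v (λ i → ∈ᴸ-⊙-zero (X⊆Y (row-∈ᴸ X i)) Yv≡0)

FullColRank-factorʳ : ∀ {r k} {X Y : Mat r k} {T : Mat k k} → IsUpperTriangular T →
                      (∀ i → Y i · T ≗ X i) → FullColRank X → FullColRank Y
FullColRank-factorʳ {X = X} {Y} {T} ut Y·T≗X fcrX v Yv≡0 i
  with d , w , d≢0 , solves ← triangular-solve ut v =
  ℤₚ.*-cancelˡ-≡ d (v i) 0ℤ {{d≢0}} (begin
    d * v i  ≡⟨ solves i ⟨
    T i ⊙ w  ≡⟨ ⊙-zeroʳ (T i) (fcrX w Xw≡0) ⟩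
    0ℤ       ≡⟨ ℤₚ.*-zeroʳ d ⟨
    d * 0ℤ   ∎)
  where
  open ≡-Reasoning
  Xw≡0 : ∀ k → X k ⊙ w ≡ 0ℤ
  Xw≡0 k = begin
    X k ⊙ w                ≡⟨ ⊙-congˡ w (sym ∘ Y·T≗X k) ⟩
    (Y k · T) ⊙ w          ≡⟨ ·-⊙-assoc (Y k) T w ⟩
    Y k ⊙ (λ i → T i ⊙ w)  ≡⟨ ⊙-congʳ (Y k) solves ⟩
    Y k ⊙ (d *ᵥ v)         ≡⟨ ⊙-*ʳ (Y k) d v ⟩
    d * (Y k ⊙ v)          ≡⟨ cong (d *_) (Yv≡0 k) ⟩
    d * 0ℤ                 ≡⟨ ℤₚ.*-zeroʳ d ⟩
    0ℤ                     ∎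

∷-∈ᴸ-lowerBlock : ∀ {r c} {X : Mat (suc r) (suc c)} {w} →
                  (∀ i → X (suc i) zero ≡ 0ℤ) → w ∈ᴸ lowerRight X → 0ℤ ∷ w ∈ᴸ X
∷-∈ᴸ-lowerBlock {X = X} column₀≡0 ⟨ q , q·X′≗w ⟩ = ⟨ 0ℤ ∷ q , (λ where
  zero    → trans (ℤₚ.+-identityˡ _)
                  (sumF-zero (λ i → trans (cong (q i *_) (column₀≡0 i)) (ℤₚ.*-zeroʳ (q i))))
  (suc j) → trans (ℤₚ.+-identityˡ _) (q·X′≗w j)) ⟩

divMod : ∀ y h → 0ℤ < h → ∃₂ λ s x → y ≡ x + s * h × 0ℤ ≤ x × x < h
divMod y h 0<h =
  y / h , ℤ.+ (y % h) , a≡a%n+[a/n]*n y h , +≤+ z≤n ,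
  subst (ℤ.+ (y % h) <_) (ℤₚ.0≤i⇒+∣i∣≡i (ℤₚ.<⇒≤ 0<h)) (+<+ (n%d<d y h))
  where
  instance
    h≢0 : ℤ.NonZero h
    h≢0 = ℤ.>-nonZero 0<h

Reduced : ∀ {k} → Mat k k → RowVec k → Set
Reduced H x = ∀ j → 0ℤ ≤ x j × x j < H j j

reduceMod : ∀ {k} {H : Mat k k} → IsUpperTriangular H →
            ∀ y → ∃ λ x → Reduced H x × y -ᵥ x ∈ᴸ H
reduceMod {zero} _ y = (λ ()) , (λ ()) , ⟨ 0ᵥ , (λ ()) ⟩
reduceMod {suc k} {H} ut y with divMod (y zero) (H zero zero) (IsUpperTriangular.diagonal-pos ut zero)
... | s , x₀ , y₀≡x₀+sh , x₀-bounds
  with x′ , x′-reduced , y′-x′∈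
         ← reduceMod (IsUpperTriangular-lowerRight ut) (tail (y -ᵥ s *ᵥ H zero)) =
  x₀ ∷ x′ , reduced ,
  ∈ᴸ-resp-≗ (+ᵥ-∈ᴸ (*ᵥ-∈ᴸ s (row-∈ᴸ H zero))
                   (∷-∈ᴸ-lowerBlock (λ i → below-zero (suc i) zero (s≤s z≤n)) y′-x′∈))
            decomposition
  where
  open IsUpperTriangular ut
  reduced : Reduced H (x₀ ∷ x′)
  reduced zero    = x₀-bounds
  reduced (suc j) = x′-reduced j
  head-eq : ∀ y x a → y ≡ x + a → a + 0ℤ ≡ y - x
  head-eq _ x a refl = ring x a
    where
    ring : ∀ x a → a + 0ℤ ≡ x + a - x
    ring = solve-∀
  tail-eq : ∀ a y x → a + (y - a - x) ≡ y - x
  tail-eq = solve-∀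
  decomposition : s *ᵥ H zero +ᵥ (0ℤ ∷ (tail (y -ᵥ s *ᵥ H zero) -ᵥ x′)) ≗ y -ᵥ (x₀ ∷ x′)
  decomposition zero    = head-eq (y zero) x₀ (s * H zero zero) y₀≡x₀+sh
  decomposition (suc j) = tail-eq (s * H zero (suc j)) (y (suc j)) (x′ j)

∣x∣≡σ*x : ∀ x → ∃ λ σ → ℤ.+ ∣ x ∣ ≡ σ * x
∣x∣≡σ*x x with ℤₚ.+∣i∣≡i⊎+∣i∣≡-i x
... | inj₁ ∣x∣≡x  = 1ℤ , trans ∣x∣≡x (sym (ℤₚ.*-identityˡ x))
... | inj₂ ∣x∣≡-x = -1ℤ , trans ∣x∣≡-x (sym (ℤₚ.-1*i≡-i x))

bézout-fromℕ : ∀ {d} a b x y → d ℕ.+ b ℕ.* ∣ y ∣ ≡ a ℕ.* ∣ x ∣ →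
               ∃₂ λ s t → s * x + t * y ≡ ℤ.+ d
bézout-fromℕ {d} a b x y eq with σ , σx ← ∣x∣≡σ*x x | τ , τy ← ∣x∣≡σ*x y =
  ℤ.+ a * σ , - (ℤ.+ b * τ) , (begin
    ℤ.+ a * σ * x + - (ℤ.+ b * τ) * y    ≡⟨ regroup (ℤ.+ a) σ x (ℤ.+ b) τ y ⟩
    ℤ.+ a * (σ * x) - ℤ.+ b * (τ * y)    ≡⟨ cong (_- ℤ.+ b * (τ * y)) eqℤ ⟨
    ℤ.+ d + ℤ.+ b * (τ * y) - ℤ.+ b * (τ * y) ≡⟨ cancel (ℤ.+ d) (ℤ.+ b * (τ * y)) ⟩
    ℤ.+ d                                ∎)
  where
  open ≡-Reasoning
  regroup : ∀ a σ x b τ y → a * σ * x + - (b * τ) * y ≡ a * (σ * x) - b * (τ * y)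
  regroup = solve-∀
  cancel : ∀ d e → d + e - e ≡ d
  cancel = solve-∀
  eqℤ : ℤ.+ d + ℤ.+ b * (τ * y) ≡ ℤ.+ a * (σ * x)
  eqℤ = begin
    ℤ.+ d + ℤ.+ b * (τ * y)     ≡⟨ cong (λ u → ℤ.+ d + ℤ.+ b * u) τy ⟨
    ℤ.+ d + ℤ.+ b * ℤ.+ ∣ y ∣   ≡⟨ cong (ℤ.+ d +_) (ℤₚ.pos-* b ∣ y ∣) ⟨
    ℤ.+ d + ℤ.+ (b ℕ.* ∣ y ∣)   ≡⟨ ℤₚ.pos-+ d (b ℕ.* ∣ y ∣) ⟨
    ℤ.+ (d ℕ.+ b ℕ.* ∣ y ∣)     ≡⟨ cong ℤ.+_ eq ⟩
    ℤ.+ (a ℕ.* ∣ x ∣)           ≡⟨ ℤₚ.pos-* a ∣ x ∣ ⟩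
    ℤ.+ a * ℤ.+ ∣ x ∣           ≡⟨ cong (ℤ.+ a *_) σx ⟩
    ℤ.+ a * (σ * x)             ∎

bézout : ∀ x y → ∃₂ λ s t → s * x + t * y ≡ gcd x y
bézout x y with ℕGCD.Bézout.identity (ℕGCD.gcd-GCD ∣ x ∣ ∣ y ∣)
... | ℕGCD.Bézout.+- a b eq = bézout-fromℕ a b x y eq
... | ℕGCD.Bézout.-+ a b eq with s , t , eq′ ← bézout-fromℕ b a y x eq =
  t , s , trans (ℤₚ.+-comm (t * x) (s * y)) eq′

gcdᵥ : ∀ {r} → RowVec r → ℤ
gcdᵥ = foldr gcd 0ℤ

gcdᵥ-∣ : ∀ {r} (f : RowVec r) i → gcdᵥ f ∣ f i
gcdᵥ-∣ f zero    = ∣ᵤ⇒∣ (gcd[i,j]∣i (f zero) (gcdᵥ (tail f)))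
gcdᵥ-∣ f (suc i) = ∣-trans (∣ᵤ⇒∣ (gcd[i,j]∣j (f zero) (gcdᵥ (tail f)))) (gcdᵥ-∣ (tail f) i)

gcdᵥ-combination : ∀ {r} (f : RowVec r) → ∃ λ a → a ⊙ f ≡ gcdᵥ f
gcdᵥ-combination {zero} f = (λ ()) , refl
gcdᵥ-combination {suc r} f
  with a′ , a′⊙f′≡g′ ← gcdᵥ-combination (tail f)
     | s , t , bézout-eq ← bézout (f zero) (gcdᵥ (tail f)) =
  s ∷ t *ᵥ a′ ,
  trans (cong (s * f zero +_) (trans (⊙-*ˡ t a′ (tail f)) (cong (t *_) a′⊙f′≡g′))) bézout-eq

gcdᵥ-nonneg : ∀ {r} (f : RowVec r) → 0ℤ ≤ gcdᵥ f
gcdᵥ-nonneg {zero}  f = +≤+ z≤n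
gcdᵥ-nonneg {suc r} f = +≤+ z≤n

gcdᵥ-pos : ∀ {r} (f : RowVec r) → ¬ (∀ i → f i ≡ 0ℤ) → 0ℤ < gcdᵥ f
gcdᵥ-pos f f≢0 = ℤₚ.≤∧≢⇒< (gcdᵥ-nonneg f) (λ 0≡g → f≢0 (λ i → f≡0 i 0≡g))
  where
  f≡0 : ∀ i → 0ℤ ≡ gcdᵥ f → f i ≡ 0ℤ
  f≡0 i 0≡g with divides c fᵢ≡cg ← gcdᵥ-∣ f i =
    trans fᵢ≡cg (trans (cong (c *_) (sym 0≡g)) (ℤₚ.*-zeroʳ c))

FullColRank⇒column≢0 : ∀ {r m} {G : Mat r (suc m)} → FullColRank G → ¬ (∀ i → G i zero ≡ 0ℤ)
FullColRank⇒column≢0 {G = G} fcr column≡0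
  with fcr (λ j → identity j zero) (λ i → trans (sumF-select (G i) zero) (column≡0 i)) zero
... | ()

bordered : ∀ {r c} → RowVec (suc c) → Mat r c → Mat (suc r) (suc c)
bordered h X = h ∷ λ i → 0ℤ ∷ X i

clearColumn-≈ᴸ : ∀ {r m} {G : Mat r (suc m)} {h} (c : RowVec r) → h ∈ᴸ G →
                 (∀ i → G i zero ≡ c i * h zero) → G ≈ᴸ bordered h (λ i → tail (G i -ᵥ c i *ᵥ h))
clearColumn-≈ᴸ {r} {m} {G} {h} c h∈G column≡ch = ≈ᴸ-byRows G⊆E E⊆G
  where
  E : Mat (suc r) (suc m)
  E = bordered h (λ i → tail (G i -ᵥ c i *ᵥ h))
  split : ∀ i → c i *ᵥ h +ᵥ E (suc i) ≗ G i
  split i zero    = trans (ℤₚ.+-identityʳ _) (sym (column≡ch i))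
  split i (suc j) = x+[y-x]≡y (c i * h (suc j)) (G i (suc j))
  cleared : ∀ i → G i -ᵥ c i *ᵥ h ≗ E (suc i)
  cleared i zero    = ℤₚ.i≡j⇒i-j≡0 (column≡ch i)
  cleared i (suc j) = refl
  G⊆E : ∀ i → G i ∈ᴸ E
  G⊆E i = ∈ᴸ-resp-≗ (+ᵥ-∈ᴸ (*ᵥ-∈ᴸ (c i) (row-∈ᴸ E zero)) (row-∈ᴸ E (suc i))) (split i)
  E⊆G : ∀ i → E i ∈ᴸ G
  E⊆G zero    = h∈G
  E⊆G (suc i) = ∈ᴸ-resp-≗ (-ᵥ-∈ᴸ (row-∈ᴸ G i) (*ᵥ-∈ᴸ (c i) h∈G)) (cleared i)

-- A kernel vector v′ of X extends to the kernel vector (-(tail h ⊙ v′)) ∷ h₀ v′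
-- of the bordered matrix.
FullColRank-bordered : ∀ {r m} {h : RowVec (suc m)} {X : Mat r m} →
                       ℤ.NonZero (h zero) → FullColRank (bordered h X) → FullColRank X
FullColRank-bordered {m = m} {h} {X} h₀≢0 fcr v′ Xv′≡0 j =
  ℤₚ.*-cancelˡ-≡ g (v′ j) 0ℤ {{h₀≢0}} (trans (fcr v kernel (suc j)) (sym (ℤₚ.*-zeroʳ g)))
  where
  open ≡-Reasoning
  g S : ℤ
  g = h zero
  S = tail h ⊙ v′
  v : RowVec (suc m)
  v = - S ∷ g *ᵥ v′
  cancel : ∀ g S → g * - S + g * S ≡ 0ℤ
  cancel = solve-∀
  kernel : ∀ i → bordered h X i ⊙ v ≡ 0ℤ
  kernel zero = begin
    g * - S + tail h ⊙ (g *ᵥ v′)  ≡⟨ cong (g * - S +_) (⊙-*ʳ (tail h) g v′) ⟩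
    g * - S + g * S               ≡⟨ cancel g S ⟩
    0ℤ                            ∎
  kernel (suc i) = begin
    0ℤ + X i ⊙ (g *ᵥ v′)  ≡⟨ ℤₚ.+-identityˡ _ ⟩
    X i ⊙ (g *ᵥ v′)       ≡⟨ ⊙-*ʳ (X i) g v′ ⟩
    g * (X i ⊙ v′)        ≡⟨ cong (g *_) (Xv′≡0 i) ⟩
    g * 0ℤ                ≡⟨ ℤₚ.*-zeroʳ g ⟩
    0ℤ                    ∎

bordered-IsHermiteForm : ∀ {m} {g} {x : RowVec m} {H : Mat m m} →
                         0ℤ < g → Reduced H x → IsHermiteForm H → IsHermiteForm (bordered (g ∷ x) H)
bordered-IsHermiteForm {m} {g} {x} {H} 0<g x-reduced (below , diagonal , above) =
  below′ , diagonal′ , above′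
  where
  B : Mat (suc m) (suc m)
  B = bordered (g ∷ x) H
  below′ : ∀ i j → toℕ j ℕ.< toℕ i → B i j ≡ 0ℤ
  below′ (suc i) zero    _         = refl
  below′ (suc i) (suc j) (s≤s j<i) = below i j j<i
  diagonal′ : ∀ i → 0ℤ < B i i
  diagonal′ zero    = 0<g
  diagonal′ (suc i) = diagonal i
  above′ : ∀ i j → toℕ i ℕ.< toℕ j → 0ℤ ≤ B i j × B i j < B j j
  above′ zero    (suc j) _         = x-reduced j
  above′ (suc i) (suc j) (s≤s i<j) = above i j i<j

bordered-≈ᴸ : ∀ {r s m} {h : RowVec (suc m)} {G : Mat r m} {H : Mat s m} {x} →
              G ≈ᴸ H → tail h -ᵥ x ∈ᴸ H → bordered h G ≈ᴸ bordered (h zero ∷ x) H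
bordered-≈ᴸ {h = h} {G} {H} {x} (G⊆H , H⊆G) tailh-x∈H = ≈ᴸ-byRows rowsˡ rowsʳ
  where
  rowsˡ : ∀ i → bordered h G i ∈ᴸ bordered (h zero ∷ x) H
  rowsˡ zero    = ∈ᴸ-resp-≗ (+ᵥ-∈ᴸ (row-∈ᴸ (bordered (h zero ∷ x) H) zero)
                                   (∷-∈ᴸ-lowerBlock (λ _ → refl) tailh-x∈H))
                            λ { zero → ℤₚ.+-identityʳ (h zero) ; (suc j) → x+[y-x]≡y (x j) (h (suc j)) }
  rowsˡ (suc i) = ∷-∈ᴸ-lowerBlock (λ _ → refl) (G⊆H (row-∈ᴸ G i))
  rowsʳ : ∀ i → bordered (h zero ∷ x) H i ∈ᴸ bordered h G
  rowsʳ zero    = ∈ᴸ-resp-≗ (-ᵥ-∈ᴸ (row-∈ᴸ (bordered h G) zero)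
                                   (∷-∈ᴸ-lowerBlock (λ _ → refl) (H⊆G tailh-x∈H)))
                            λ { zero → ℤₚ.+-identityʳ (h zero) ; (suc j) → x-[x-y]≡y (h (suc j)) (x j) }
  rowsʳ (suc i) = ∷-∈ᴸ-lowerBlock (λ _ → refl) (H⊆G (row-∈ᴸ H i))

-- Column by column: g = gcd of the first column is attained by a lattice vector h;
-- subtracting multiples of h clears that column and we recurse on the rest.
hermiteBasis : ∀ {r} m (G : Mat r m) → FullColRank G → ∃ λ H → IsHermiteForm H × H ≈ᴸ G
hermiteBasis zero    G _ =
  (λ ()) , ((λ ()) , (λ ()) , (λ ())) , (λ _ → ⟨ 0ᵥ , (λ ()) ⟩) , (λ _ → ⟨ 0ᵥ , (λ ()) ⟩)
hermiteBasis {r} (suc m) G fcr =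
  bordered (h zero ∷ x) H′ ,
  bordered-IsHermiteForm h₀>0 x-reduced H′-hf ,
  ≈ᴸ-sym (≈ᴸ-trans G≈E (bordered-≈ᴸ (≈ᴸ-sym H′≈G′) tailh-x∈H′))
  where
  f : RowVec r
  f i = G i zero
  a c : RowVec r
  a   = proj₁ (gcdᵥ-combination f)
  c i = quotient (gcdᵥ-∣ f i)
  h : RowVec (suc m)
  h = a · G
  h₀≡g : h zero ≡ gcdᵥ f
  h₀≡g = proj₂ (gcdᵥ-combination f)
  h₀>0 : 0ℤ < h zero
  h₀>0 = subst (0ℤ <_) (sym h₀≡g) (gcdᵥ-pos f (FullColRank⇒column≢0 {G = G} fcr))
  G′ : Mat r m
  G′ i = tail (G i -ᵥ c i *ᵥ h)
  G≈E : G ≈ᴸ bordered h G′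
  G≈E = clearColumn-≈ᴸ c (·-∈ᴸ a G)
          λ i → trans (_∣_.equality (gcdᵥ-∣ f i)) (cong (c i *_) (sym h₀≡g))
  recursion : ∃ λ H′ → IsHermiteForm H′ × H′ ≈ᴸ G′
  recursion = hermiteBasis m G′
                (FullColRank-bordered (ℤ.>-nonZero h₀>0) (FullColRank-⊆ᴸ (proj₁ G≈E) fcr))
  H′ : Mat m m
  H′ = proj₁ recursion
  H′-hf : IsHermiteForm H′
  H′-hf = proj₁ (proj₂ recursion)
  H′≈G′ : H′ ≈ᴸ G′
  H′≈G′ = proj₂ (proj₂ recursion)
  reduction : ∃ λ x → Reduced H′ x × tail h -ᵥ x ∈ᴸ H′
  reduction = reduceMod (IsHermiteForm⇒IsUpperTriangular H′-hf) (tail h)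
  x : RowVec m
  x = proj₁ reduction
  x-reduced : Reduced H′ x
  x-reduced = proj₁ (proj₂ reduction)
  tailh-x∈H′ : tail h -ᵥ x ∈ᴸ H′
  tailh-x∈H′ = proj₂ (proj₂ reduction)

IsHermiteForm-resp-≋ : ∀ {k} {X Y : Mat k k} → X ≋ Y → IsHermiteForm X → IsHermiteForm Y
IsHermiteForm-resp-≋ X≋Y (below , diagonal , above) =
  (λ i j j<i → trans (sym (X≋Y i j)) (below i j j<i)) ,
  (λ i → subst (0ℤ <_) (X≋Y i i) (diagonal i)) ,
  (λ i j i<j → subst₂ (λ x y → 0ℤ ≤ x × x < y) (X≋Y i j) (X≋Y j j) (above i j i<j))

identity-IsHermiteForm : ∀ {k} → IsHermiteForm (identity {k})
identity-IsHermiteForm =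
  (λ i j j<i → identity-offDiag (λ i≡j → ℕₚ.<-irrefl (cong toℕ (sym i≡j)) j<i)) ,
  (λ i → subst (0ℤ <_) (sym (identity-diag i)) (+<+ (s≤s z≤n))) ,
  (λ i j i<j → subst₂ (λ x y → 0ℤ ≤ x × x < y)
                      (sym (identity-offDiag (λ i≡j → ℕₚ.<-irrefl (cong toℕ i≡j) i<j)))
                      (sym (identity-diag j))
                      (+≤+ z≤n , +<+ (s≤s z≤n)))

blockUpper : ∀ {a b} → Mat a a → Mat a b → Mat b b → Mat (a ℕ.+ b) (a ℕ.+ b)
blockUpper {a} {b} A B D = (A ∥ B) ⊤⊥ (zeroMat {b} {a} ∥ D)

toℕ-splitAt-inj₁ : ∀ a {b} {i : Fin (a ℕ.+ b)} {i′} → splitAt a i ≡ inj₁ i′ → toℕ i ≡ toℕ i′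
toℕ-splitAt-inj₁ a eq = trans (cong toℕ (sym (splitAt⁻¹-↑ˡ eq))) (toℕ-↑ˡ _ _)

toℕ-splitAt-inj₂ : ∀ a {b} {i : Fin (a ℕ.+ b)} {i′} → splitAt a i ≡ inj₂ i′ → toℕ i ≡ a ℕ.+ toℕ i′
toℕ-splitAt-inj₂ a eq = trans (cong toℕ (sym (splitAt⁻¹-↑ʳ eq))) (toℕ-↑ʳ a _)

splitAt-inj₁-< : ∀ a {b} {i j : Fin (a ℕ.+ b)} {i′ j′} →
                 splitAt a i ≡ inj₁ i′ → splitAt a j ≡ inj₁ j′ → toℕ i ℕ.< toℕ j → toℕ i′ ℕ.< toℕ j′
splitAt-inj₁-< a eqᵢ eqⱼ = subst₂ ℕ._<_ (toℕ-splitAt-inj₁ a eqᵢ) (toℕ-splitAt-inj₁ a eqⱼ)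

splitAt-inj₂-< : ∀ a {b} {i j : Fin (a ℕ.+ b)} {i′ j′} →
                 splitAt a i ≡ inj₂ i′ → splitAt a j ≡ inj₂ j′ → toℕ i ℕ.< toℕ j → toℕ i′ ℕ.< toℕ j′
splitAt-inj₂-< a eqᵢ eqⱼ =
  ℕₚ.+-cancelˡ-< a _ _ ∘ subst₂ ℕ._<_ (toℕ-splitAt-inj₂ a eqᵢ) (toℕ-splitAt-inj₂ a eqⱼ)

splitAt-inj₂-inj₁-≮ : ∀ a {b} {i j : Fin (a ℕ.+ b)} {i′ j′} →
                      splitAt a i ≡ inj₂ i′ → splitAt a j ≡ inj₁ j′ → ¬ toℕ i ℕ.< toℕ j
splitAt-inj₂-inj₁-≮ a {j′ = j′} eqᵢ eqⱼ i<j =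
  ℕₚ.<-asym (toℕ<n j′)
            (ℕₚ.≤-<-trans (ℕₚ.m≤m+n a _)
                          (subst₂ ℕ._<_ (toℕ-splitAt-inj₂ a eqᵢ) (toℕ-splitAt-inj₁ a eqⱼ) i<j))

blockUpper-IsHermiteForm : ∀ {a b} {A : Mat a a} {B : Mat a b} {D : Mat b b} →
                           IsHermiteForm A → IsHermiteForm D → (∀ i → Reduced D (B i)) →
                           IsHermiteForm (blockUpper A B D)
blockUpper-IsHermiteForm {a} {b} {A} {B} {D} (belowA , diagonalA , aboveA) (belowD , diagonalD , aboveD)
                         B-reduced = below , diagonal , above
  where
  E : Mat (a ℕ.+ b) (a ℕ.+ b)
  E = blockUpper A B D
  below : ∀ i j → toℕ j ℕ.< toℕ i → E i j ≡ 0ℤ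
  below i j j<i with splitAt a i in eqᵢ | splitAt a j in eqⱼ
  ... | inj₁ i′ | inj₁ j′ = belowA i′ j′ (splitAt-inj₁-< a eqⱼ eqᵢ j<i)
  ... | inj₁ _  | inj₂ _  = ⊥-elim (splitAt-inj₂-inj₁-≮ a eqⱼ eqᵢ j<i)
  ... | inj₂ _  | inj₁ _  = refl
  ... | inj₂ i′ | inj₂ j′ = belowD i′ j′ (splitAt-inj₂-< a eqⱼ eqᵢ j<i)
  diagonal : ∀ i → 0ℤ < E i i
  diagonal i with splitAt a i
  ... | inj₁ i′ = diagonalA i′
  ... | inj₂ i′ = diagonalD i′
  above : ∀ i j → toℕ i ℕ.< toℕ j → 0ℤ ≤ E i j × E i j < E j j
  above i j i<j with splitAt a i in eqᵢ | splitAt a j in eqⱼ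
  ... | inj₁ i′ | inj₁ j′ = aboveA i′ j′ (splitAt-inj₁-< a eqᵢ eqⱼ i<j)
  ... | inj₁ i′ | inj₂ j′ = B-reduced i′ j′
  ... | inj₂ _  | inj₁ _  = ⊥-elim (splitAt-inj₂-inj₁-≮ a eqᵢ eqⱼ i<j)
  ... | inj₂ i′ | inj₂ j′ = aboveD i′ j′ (splitAt-inj₂-< a eqᵢ eqⱼ i<j)

module Construction {l m n} (M : Mat l m) (F : Mat n m) (M-fcr : FullColRank M)
                    (T : Mat m m) (T-basis : IsHermiteBasisOfLattice T (LatSum M F)) where

  T-hf : IsHermiteForm T
  T-hf = proj₁ T-basis

  T-ut : IsUpperTriangular T
  T-ut = IsHermiteForm⇒IsUpperTriangular T-hf

  LatSum⊆T : ∀ {v} → LatSum M F v → v ∈ᴸ T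
  LatSum⊆T {v} = ∈L⇒∈ᴸ ∘ proj₂ (proj₂ T-basis v)

  M⊆T : ∀ k → M k ∈ᴸ T
  M⊆T k = LatSum⊆T (M k , 0ᵥ , ∈ᴸ⇒∈L (row-∈ᴸ M k) , ∈ᴸ⇒∈L (0ᵥ-∈ᴸ F) ,
                    λ j → sym (ℤₚ.+-identityʳ (M k j)))

  F⊆T : ∀ i → F i ∈ᴸ T
  F⊆T i = LatSum⊆T (0ᵥ , F i , ∈ᴸ⇒∈L (0ᵥ-∈ᴸ M) , ∈ᴸ⇒∈L (row-∈ᴸ F i) ,
                    λ j → sym (ℤₚ.+-identityˡ (F i j)))

  opaque
    G : Mat l m
    G k = _∈ᴸ_.coefficients (M⊆T k)

    G·T≗M : ∀ k → G k · T ≗ M k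
    G·T≗M k = _∈ᴸ_.combination (M⊆T k)

  opaque
    U : Mat n m
    U i = _∈ᴸ_.coefficients (F⊆T i)

    U·T≗F : ∀ i → U i · T ≗ F i
    U·T≗F i = _∈ᴸ_.combination (F⊆T i)

  G-fcr : FullColRank G
  G-fcr = FullColRank-factorʳ {X = M} {Y = G} T-ut G·T≗M M-fcr

  opaque
    K : Mat m m
    K = proj₁ (hermiteBasis m G G-fcr)

    K-hf : IsHermiteForm K
    K-hf = proj₁ (proj₂ (hermiteBasis m G G-fcr))

    K≈G : K ≈ᴸ G
    K≈G = proj₂ (proj₂ (hermiteBasis m G G-fcr))

  K⊆G : K ⊆ᴸ G
  K⊆G = proj₁ K≈G

  G⊆K : G ⊆ᴸ K
  G⊆K = proj₂ K≈G

  K-ut : IsUpperTriangular K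
  K-ut = IsHermiteForm⇒IsUpperTriangular K-hf

  opaque
    X : Mat m m
    X j = proj₁ (reduceMod K-ut (identity j))

    X-reduced : ∀ j → Reduced K (X j)
    X-reduced j = proj₁ (proj₂ (reduceMod K-ut (identity j)))

    I-X⊆K : ∀ j → identity j -ᵥ X j ∈ᴸ K
    I-X⊆K j = proj₂ (proj₂ (reduceMod K-ut (identity j)))

  opaque
    C : Mat n m
    C i = proj₁ (reduceMod K-ut (map -_ (U i)))

    C-reduced : ∀ i → Reduced K (C i)
    C-reduced i = proj₁ (proj₂ (reduceMod K-ut (map -_ (U i))))

    -U-C⊆K : ∀ i → map -_ (U i) -ᵥ C i ∈ᴸ K
    -U-C⊆K i = proj₂ (proj₂ (reduceMod K-ut (map -_ (U i))))

  U+C⊆K : ∀ i → U i +ᵥ C i ∈ᴸ K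
  U+C⊆K i = ∈ᴸ-resp-≗ (*ᵥ-∈ᴸ -1ℤ (-U-C⊆K i)) (λ j → negate (U i j) (C i j))
    where
    negate : ∀ u c → -1ℤ * (- u - c) ≡ u + c
    negate = solve-∀

  A₁ : Mat m (m ℕ.+ n ℕ.+ m)
  A₁ = (T ∥ zeroMat {m} {n}) ∥ identity {m}
  A₂ : Mat n (m ℕ.+ n ℕ.+ m)
  A₂ = (F ∥ identity {n}) ∥ zeroMat {n} {m}
  A₃ : Mat l (m ℕ.+ n ℕ.+ m)
  A₃ = (M ∥ zeroMat {l} {n}) ∥ zeroMat {l} {m}
  A : Mat (m ℕ.+ n ℕ.+ l) (m ℕ.+ n ℕ.+ m)
  A = A₁ ⊤⊥ A₂ ⊤⊥ A₃

  H₁ : Mat m (m ℕ.+ n ℕ.+ m)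
  H₁ = (T ∥ zeroMat {m} {n}) ∥ X
  H₂ : Mat n (m ℕ.+ n ℕ.+ m)
  H₂ = (zeroMat {n} {m} ∥ identity {n}) ∥ C
  H₃ : Mat m (m ℕ.+ n ℕ.+ m)
  H₃ = (zeroMat {m} {m} ∥ zeroMat {m} {n}) ∥ K
  H : Mat (m ℕ.+ n ℕ.+ m) (m ℕ.+ n ℕ.+ m)
  H = H₁ ⊤⊥ H₂ ⊤⊥ H₃

  A₁⊆A : A₁ ⊆ᴸ A
  A₁⊆A = ⊆ᴸ-⊤⊥ˡ ∘ ⊆ᴸ-⊤⊥ˡ
  A₂⊆A : A₂ ⊆ᴸ A
  A₂⊆A = ⊆ᴸ-⊤⊥ˡ ∘ ⊆ᴸ-⊤⊥ʳ {X = A₁}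
  A₃⊆A : A₃ ⊆ᴸ A
  A₃⊆A = ⊆ᴸ-⊤⊥ʳ
  H₁⊆H : H₁ ⊆ᴸ H
  H₁⊆H = ⊆ᴸ-⊤⊥ˡ ∘ ⊆ᴸ-⊤⊥ˡ
  H₂⊆H : H₂ ⊆ᴸ H
  H₂⊆H = ⊆ᴸ-⊤⊥ˡ ∘ ⊆ᴸ-⊤⊥ʳ {X = H₁}
  H₃⊆H : H₃ ⊆ᴸ H
  H₃⊆H = ⊆ᴸ-⊤⊥ʳ

  pad : RowVec m → RowVec (m ℕ.+ n ℕ.+ m)
  pad w = (0ᵥ {m} ++ 0ᵥ {n}) ++ w

  pad-∈ᴸ : ∀ {r} {Y : Mat r m} {w} → w ∈ᴸ Y → pad w ∈ᴸ pad ∘ Y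
  pad-∈ᴸ {Y = Y} {w} ⟨ q , q·Y≗w ⟩ = ⟨ q , padded ⟩
    where
    padded : q · (pad ∘ Y) ≗ pad w
    padded j with splitAt (m ℕ.+ n) j
    ... | inj₂ j′ = q·Y≗w j′
    ... | inj₁ j′ with splitAt m j′
    ...   | inj₁ j″ = ·-zeroMat q j″
    ...   | inj₂ j″ = ·-zeroMat q j″

  padK⊆H : ∀ {w} → w ∈ᴸ K → pad w ∈ᴸ H
  padK⊆H = H₃⊆H ∘ pad-∈ᴸ

  padG⊆A : ∀ {w} → w ∈ᴸ G → pad w ∈ᴸ A
  padG⊆A = rows⇒⊆ᴸ padG-rows ∘ pad-∈ᴸ
    where
    eliminate-M : ∀ k → G k · A₁ -ᵥ A₃ k ≗ pad (G k)
    eliminate-M k j with splitAt (m ℕ.+ n) j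
    ... | inj₂ j′ = trans (ℤₚ.+-identityʳ _) (·-identity (G k) j′)
    ... | inj₁ j′ with splitAt m j′
    ...   | inj₁ j″ = ℤₚ.i≡j⇒i-j≡0 (G·T≗M k j″)
    ...   | inj₂ j″ = trans (ℤₚ.+-identityʳ _) (·-zeroMat (G k) j″)
    padG-rows : ∀ k → pad (G k) ∈ᴸ A
    padG-rows k =
      ∈ᴸ-resp-≗ (-ᵥ-∈ᴸ (A₁⊆A (·-∈ᴸ (G k) A₁)) (A₃⊆A (row-∈ᴸ A₃ k))) (eliminate-M k)

  padK⊆A : ∀ {w} → w ∈ᴸ K → pad w ∈ᴸ A
  padK⊆A = padG⊆A ∘ K⊆G

  p-p·X∈K : ∀ (p : RowVec m) → p -ᵥ p · X ∈ᴸ K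
  p-p·X∈K p = ∈ᴸ-resp-≗ (rows⇒⊆ᴸ I-X⊆K (·-∈ᴸ p (λ i → identity i -ᵥ X i)))
                        λ j → trans (·-rows--ᵥ p identity X j)
                                    (cong (_- (p · X) j) (·-identity p j))

  U·X+C⊆K : ∀ i → U i · X +ᵥ C i ∈ᴸ K
  U·X+C⊆K i = ∈ᴸ-resp-≗ (-ᵥ-∈ᴸ (U+C⊆K i) (p-p·X∈K (U i)))
                        λ j → regroup (U i j) (C i j) ((U i · X) j)
    where
    regroup : ∀ u c x → u + c - (u - x) ≡ x + c
    regroup = solve-∀

  G·X⊆K : ∀ k → G k · X ∈ᴸ K
  G·X⊆K k = ∈ᴸ-resp-≗ (-ᵥ-∈ᴸ (G⊆K (row-∈ᴸ G k)) (p-p·X∈K (G k)))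
                      λ j → x-[x-y]≡y (G k j) ((G k · X) j)

  H-rows⊆A : ∀ i → H i ∈ᴸ A
  H-rows⊆A = rows-⊤⊥ (rows-⊤⊥ H₁-rows H₂-rows) (padK⊆A ∘ row-∈ᴸ K)
    where
    H₁-eq : ∀ i → A₁ i -ᵥ pad (identity i -ᵥ X i) ≗ H₁ i
    H₁-eq i j with splitAt (m ℕ.+ n) j
    ... | inj₂ j′ = x-[x-y]≡y (identity i j′) (X i j′)
    ... | inj₁ j′ with splitAt m j′
    ...   | inj₁ j″ = ℤₚ.+-identityʳ (T i j″)
    ...   | inj₂ j″ = refl
    H₁-rows : ∀ i → H₁ i ∈ᴸ A
    H₁-rows i = ∈ᴸ-resp-≗ (-ᵥ-∈ᴸ (A₁⊆A (row-∈ᴸ A₁ i)) (padK⊆A (I-X⊆K i))) (H₁-eq i)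
    cancel-U : ∀ u c → 0ℤ - u + (u + c) ≡ c
    cancel-U = solve-∀
    H₂-eq : ∀ i → A₂ i -ᵥ U i · A₁ +ᵥ pad (U i +ᵥ C i) ≗ H₂ i
    H₂-eq i j with splitAt (m ℕ.+ n) j
    ... | inj₂ j′ = trans (cong (λ u → 0ℤ - u + (U i j′ + C i j′)) (·-identity (U i) j′))
                          (cancel-U (U i j′) (C i j′))
    ... | inj₁ j′ with splitAt m j′
    ...   | inj₁ j″ = trans (ℤₚ.+-identityʳ _) (ℤₚ.i≡j⇒i-j≡0 (sym (U·T≗F i j″)))
    ...   | inj₂ j″ = trans (ℤₚ.+-identityʳ _)
                            (trans (cong (λ z → identity i j″ - z) (·-zeroMat (U i) j″))
                                   (ℤₚ.+-identityʳ _))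
    H₂-rows : ∀ i → H₂ i ∈ᴸ A
    H₂-rows i = ∈ᴸ-resp-≗ (+ᵥ-∈ᴸ (-ᵥ-∈ᴸ (A₂⊆A (row-∈ᴸ A₂ i)) (A₁⊆A (·-∈ᴸ (U i) A₁)))
                                 (padK⊆A (U+C⊆K i)))
                          (H₂-eq i)

  A-rows⊆H : ∀ i → A i ∈ᴸ H
  A-rows⊆H = rows-⊤⊥ (rows-⊤⊥ A₁-rows A₂-rows) A₃-rows
    where
    A₁-eq : ∀ i → H₁ i +ᵥ pad (identity i -ᵥ X i) ≗ A₁ i
    A₁-eq i j with splitAt (m ℕ.+ n) j
    ... | inj₂ j′ = x+[y-x]≡y (X i j′) (identity i j′)
    ... | inj₁ j′ with splitAt m j′
    ...   | inj₁ j″ = ℤₚ.+-identityʳ (T i j″)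
    ...   | inj₂ j″ = refl
    A₁-rows : ∀ i → A₁ i ∈ᴸ H
    A₁-rows i = ∈ᴸ-resp-≗ (+ᵥ-∈ᴸ (H₁⊆H (row-∈ᴸ H₁ i)) (padK⊆H (I-X⊆K i))) (A₁-eq i)
    A₂-eq : ∀ i → U i · H₁ +ᵥ H₂ i -ᵥ pad (U i · X +ᵥ C i) ≗ A₂ i
    A₂-eq i j with splitAt (m ℕ.+ n) j
    ... | inj₂ j′ = ℤₚ.+-inverseʳ ((U i · X) j′ + C i j′)
    ... | inj₁ j′ with splitAt m j′
    ...   | inj₁ j″ = trans (ℤₚ.+-identityʳ _) (trans (ℤₚ.+-identityʳ _) (U·T≗F i j″))
    ...   | inj₂ j″ = trans (ℤₚ.+-identityʳ _)
                            (trans (cong (_+ identity i j″) (·-zeroMat (U i) j″))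
                                   (ℤₚ.+-identityˡ _))
    A₂-rows : ∀ i → A₂ i ∈ᴸ H
    A₂-rows i = ∈ᴸ-resp-≗ (-ᵥ-∈ᴸ (+ᵥ-∈ᴸ (H₁⊆H (·-∈ᴸ (U i) H₁)) (H₂⊆H (row-∈ᴸ H₂ i)))
                                 (padK⊆H (U·X+C⊆K i)))
                          (A₂-eq i)
    A₃-eq : ∀ k → G k · H₁ -ᵥ pad (G k · X) ≗ A₃ k
    A₃-eq k j with splitAt (m ℕ.+ n) j
    ... | inj₂ j′ = ℤₚ.+-inverseʳ ((G k · X) j′)
    ... | inj₁ j′ with splitAt m j′
    ...   | inj₁ j″ = trans (ℤₚ.+-identityʳ _) (G·T≗M k j″)
    ...   | inj₂ j″ = trans (ℤₚ.+-identityʳ _) (·-zeroMat (G k) j″)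
    A₃-rows : ∀ k → A₃ k ∈ᴸ H
    A₃-rows k = ∈ᴸ-resp-≗ (-ᵥ-∈ᴸ (H₁⊆H (·-∈ᴸ (G k) H₁)) (padK⊆H (G·X⊆K k))) (A₃-eq k)

  H≈A : H ≈ᴸ A
  H≈A = ≈ᴸ-byRows H-rows⊆A A-rows⊆H

  ·M≗·G·T : ∀ q → q · M ≗ (q · G) · T
  ·M≗·G·T = ·-factor {X = M} {Y = G} G·T≗M

  ·F≗·U·T : ∀ p → p · F ≗ (p · U) · T
  ·F≗·U·T = ·-factor {X = F} {Y = U} U·T≗F

  H≋blocks : H ≋ blockUpper (blockUpper T (zeroMat {m} {n}) identity) (X ⊤⊥ C) K
  H≋blocks i j with splitAt (m ℕ.+ n) i | splitAt (m ℕ.+ n) j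
  ... | inj₂ _  | inj₂ _  = refl
  ... | inj₂ _  | inj₁ j′ with splitAt m j′
  ...   | inj₁ _ = refl
  ...   | inj₂ _ = refl
  H≋blocks i j | inj₁ i′ | inj₂ _ with splitAt m i′
  ...   | inj₁ _ = refl
  ...   | inj₂ _ = refl
  H≋blocks i j | inj₁ i′ | inj₁ j′ with splitAt m i′ | splitAt m j′
  ...   | inj₁ _ | inj₁ _ = refl
  ...   | inj₁ _ | inj₂ _ = refl
  ...   | inj₂ _ | inj₁ _ = refl
  ...   | inj₂ _ | inj₂ _ = refl

  H-hf : IsHermiteForm H
  H-hf = IsHermiteForm-resp-≋ (λ i j → sym (H≋blocks i j))
           (blockUpper-IsHermiteForm
              (blockUpper-IsHermiteForm T-hf identity-IsHermiteForm zero-reduced) K-hf XC-reduced)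
    where
    zero-reduced : ∀ i → Reduced identity (zeroMat {m} {n} i)
    zero-reduced i j = +≤+ z≤n , subst (0ℤ <_) (sym (identity-diag j)) (+<+ (s≤s z≤n))
    XC-reduced : ∀ i → Reduced K ((X ⊤⊥ C) i)
    XC-reduced i with splitAt m i
    ... | inj₁ i′ = X-reduced i′
    ... | inj₂ i′ = C-reduced i′

  ∈R[M,F]⇒·U∈G : ∀ p → p ∈R[ M , F ] → p · U ∈ᴸ G
  ∈R[M,F]⇒·U∈G p (q , p·F≗q·M) = ⟨ q , (λ j → sym (·-cancelʳ T-ut (p · U) (q · G) same j)) ⟩
    where
    same : (p · U) · T ≗ (q · G) · T
    same j = trans (sym (·F≗·U·T p j)) (trans (p·F≗q·M j) (·M≗·G·T q j))

  ·U∈G⇒∈R[M,F] : ∀ p → p · U ∈ᴸ G → p ∈R[ M , F ]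
  ·U∈G⇒∈R[M,F] p ⟨ q , q·G≗p·U ⟩ = q , λ j → begin
    (p · F) j        ≡⟨ ·F≗·U·T p j ⟩
    ((p · U) · T) j  ≡⟨ ·-cong {X = T} {Y = T} (sym ∘ q·G≗p·U) (λ _ _ → refl) j ⟩
    ((q · G) · T) j  ≡⟨ ·M≗·G·T q j ⟨
    (q · M) j        ∎
    where open ≡-Reasoning

  ·U+·C∈K : ∀ p → p · U +ᵥ p · C ∈ᴸ K
  ·U+·C∈K p = ∈ᴸ-resp-≗ (rows⇒⊆ᴸ U+C⊆K (·-∈ᴸ p (λ i → U i +ᵥ C i))) (·-rows-+ᵥ p U C)

  ·C∈K : ∀ p → p ∈R[ M , F ] → p · C ∈ᴸ K
  ·C∈K p p∈R = ∈ᴸ-resp-≗ (-ᵥ-∈ᴸ (·U+·C∈K p) (G⊆K (∈R[M,F]⇒·U∈G p p∈R)))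
                         (λ j → x+y-x≡y ((p · U) j) ((p · C) j))

  ·C∈K⇒∈R[K,C] : ∀ p → p · C ∈ᴸ K → p ∈R[ K , C ]
  ·C∈K⇒∈R[K,C] p ⟨ q , q·K≗p·C ⟩ = q , λ j → sym (q·K≗p·C j)

  ∈R[K,C]⇒·U∈K : ∀ p → p ∈R[ K , C ] → p · U ∈ᴸ K
  ∈R[K,C]⇒·U∈K p (q , p·C≗q·K) =
    ∈ᴸ-resp-≗ (-ᵥ-∈ᴸ (·U+·C∈K p) ⟨ q , (λ j → sym (p·C≗q·K j)) ⟩)
              λ j → x+y-y≡x ((p · U) j) ((p · C) j)

  ∈R[M,F]⇔∈R[K,C] : ∀ p → (p ∈R[ M , F ] → p ∈R[ K , C ]) ×
                           (p ∈R[ K , C ] → p ∈R[ M , F ])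
  ∈R[M,F]⇔∈R[K,C] p = ·C∈K⇒∈R[K,C] p ∘ ·C∈K p , ·U∈G⇒∈R[M,F] p ∘ K⊆G ∘ ∈R[K,C]⇒·U∈K p

  U⊆K⊤⊥C : ∀ i → U i ∈ᴸ K ⊤⊥ C
  U⊆K⊤⊥C i = ∈ᴸ-resp-≗ (-ᵥ-∈ᴸ (⊆ᴸ-⊤⊥ˡ (U+C⊆K i)) (⊆ᴸ-⊤⊥ʳ (row-∈ᴸ C i)))
                       λ j → x+y-y≡x (U i j) (C i j)

  identity⊆K⊤⊥C : ∀ j → identity j ∈ᴸ K ⊤⊥ C
  identity⊆K⊤⊥C j with proj₁ (proj₂ T-basis (T j)) (∈ᴸ⇒∈L (row-∈ᴸ T j))
  ... | a , b , (α , α·M≗a) , (β , β·F≗b) , Tⱼ≡a+b =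
    ∈ᴸ-resp-≗ (+ᵥ-∈ᴸ (⊆ᴸ-⊤⊥ˡ (G⊆K (·-∈ᴸ α G))) (rows⇒⊆ᴸ U⊆K⊤⊥C (·-∈ᴸ β U)))
              (·-cancelʳ T-ut (α · G +ᵥ β · U) (identity j) same)
    where
    open ≡-Reasoning
    same : (α · G +ᵥ β · U) · T ≗ identity j · T
    same t = begin
      ((α · G +ᵥ β · U) · T) t           ≡⟨ ·-+ᵥ (α · G) (β · U) T t ⟩
      ((α · G) · T) t + ((β · U) · T) t  ≡⟨ cong₂ _+_ (·M≗·G·T α t) (·F≗·U·T β t) ⟨
      (α · M) t + (β · F) t              ≡⟨ cong₂ _+_ (α·M≗a t) (β·F≗b t) ⟩
      a t + b t                          ≡⟨ Tⱼ≡a+b t ⟨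
      T j t                              ≡⟨ identity-· j T t ⟨
      (identity j · T) t                 ∎

  K-C-coprime : Coprime K C
  K-C-coprime =
    FullColRank-⊆ᴸ {X = G} (⊆ᴸ-⊤⊥ˡ ∘ G⊆K) G-fcr ,
    ≈ᴸ⇒IsHermiteBasis identity-IsHermiteForm
      (≈ᴸ-byRows identity⊆K⊤⊥C (λ i → ⟨ (K ⊤⊥ C) i , ·-identity ((K ⊤⊥ C) i) ⟩))

theorem20 : (l m n : ℕ) (M : Mat l m) (F : Mat n m) → FullColRank M →
    (T : Mat m m) → IsHermiteBasisOfLattice T (LatSum M F) →
    ∃ λ (C : Mat n m) → ∃ λ (K : Mat m m) → ∃ λ (X : Mat m m) → ∃ λ (H : Mat (m Data.Nat.+ n Data.Nat.+ m) (m Data.Nat.+ n Data.Nat.+ m)) →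
      IsHermiteBasis H
        (((T ∥ zeroMat {m} {n}) ∥ identity {m}) ⊤⊥ ((F ∥ identity {n}) ∥ zeroMat {n} {m}) ⊤⊥ ((M ∥ zeroMat {l} {n}) ∥ zeroMat {l} {m})) ×
      H ≋ (((T ∥ zeroMat {m} {n}) ∥ X) ⊤⊥ ((zeroMat {n} {m} ∥ identity {n}) ∥ C) ⊤⊥ ((zeroMat {m} {m} ∥ zeroMat {m} {n}) ∥ K)) ×
      (∀ p → (p ∈R[ M , F ] → p ∈R[ K , C ]) × (p ∈R[ K , C ] → p ∈R[ M , F ])) ×
      Coprime K C
theorem20 l m n M F M-fcr T T-basis =
  C , K , X , H , ≈ᴸ⇒IsHermiteBasis H-hf H≈A , (λ _ _ → refl) , ∈R[M,F]⇔∈R[K,C] , K-C-coprime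
  where open Construction M F M-fcr T T-basis
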